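{- Let $A \in \{0,1\}^{n\times n}$ be a square matrix with $A_{i,i} = 0$ for all $i \in [n]$, and let $G$ be the upper graph of $A$. For any $d \in \mathbb{N}$, if $\mathrm{VCdim}(G) \geq 4d$ then $\mathrm{VCdim}(A) \geq d$. Consequently, if $\mathrm{VCdim}(A) \leq d$, then $\mathrm{VCdim}(G) \leq 4d+3$.
   Context: The upper graph of a square matrix $A$ of size $n$ is the graph on vertex set $[n]$ with edge set $\{\{i,j\} : i<j,\ A_{i,j}=1\}$. For a set system $(X,\mathcal{F})$, $Y\subseteq X$ is shattered if $|\{Y\cap S : S\in\mathcal{F}\}| = 2^{|Y|}$; the VC-dimension is the largest size of a shattered set. $\mathrm{VCdim}(G)$ is the VC-dimension of the neighbourhood system $(V(G), \{N(v): v\in V(G)\})$. $\mathrm{VCdim}(A)$ for $A\in\{0,1\}^{m\times n}$ is the maximum of the VC-dimensions of its column system $([m], \{\{i : A_{i,j}=1\} : j\in[n]\})$ and its row system $([n], \{\{j : A_{i,j}=1\} : i\in[m]\})$. -}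

module Defs where

open import Data.Nat using (ℕ)
open import Data.Bool using (Bool; true; false; _∧_; _∨_)
open import Data.Fin using (Fin; _<?_)
open import Data.Fin.Subset using (Subset; _⊆_; _∩_; ∣_∣)
open import Data.Vec using (tabulate)
open import Data.Product using (∃; Σ; _×_)
open import Relation.Nullary using (does)
open import Relation.Binary.PropositionalEquality using (_≡_)
open import Data.Nat using (_≤_)

-- A 0/1 matrix of size m × n (entry true = 1)
Matrix : ℕ → ℕ → Set
Matrix m n = Fin m → Fin n → Bool

Family : ℕ → ℕ → Set
Family m k = Fin k → Subset m

Shattered : ∀ {m k} → Family m k → Subset m → Set
Shattered F Y = ∀ Z → Z ⊆ Y → ∃ λ j → Y ∩ F j ≡ Z

VCdim≥ : ∀ {m k} → Family m k → ℕ → Set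
VCdim≥ F d = Σ _ λ Y → ∣ Y ∣ ≡ d × Shattered F Y

VCdim≤ : ∀ {m k} → Family m k → ℕ → Set
VCdim≤ F d = ∀ Y → Shattered F Y → ∣ Y ∣ ≤ d

columns : ∀ {m n} → Matrix m n → Family m n
columns A j = tabulate λ i → A i j

rows : ∀ {m n} → Matrix m n → Family n m
rows A i = tabulate λ j → A i j

-- VCdim(A) ≥ d  (max of the two VC-dimensions is ≥ d)
MatVCdim≥ : ∀ {m n} → Matrix m n → ℕ → Set
MatVCdim≥ A d = VCdim≥ (columns A) d ⊎' VCdim≥ (rows A) d
  where open import Data.Sum using () renaming (_⊎_ to _⊎'_)

-- VCdim(A) ≤ d  (max of the two VC-dimensions is ≤ d)
MatVCdim≤ : ∀ {m n} → Matrix m n → ℕ → Set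
MatVCdim≤ A d = VCdim≤ (columns A) d × VCdim≤ (rows A) d

upperAdj : ∀ {n} → Matrix n n → Fin n → Fin n → Bool
upperAdj A u v = (does (u <? v) ∧ A u v) ∨ (does (v <? u) ∧ A v u)

upperNbhd : ∀ {n} → Matrix n n → Family n n
upperNbhd A v = tabulate λ u → upperAdj A v u

-- If Y is shattered by the neighbourhoods of the upper graph, split off its first d
-- elements B₁ and the next d elements B₂. Were B₁ not shattered by the columns and
-- B₂ not by the rows, pick untraced C ⊆ B₁ and R ⊆ B₂ and a vertex v with
-- Y ∩ N(v) = C ∪ R. If v lies above all of B₁, then N(v) agrees with column v on B₁
-- and traces C there; otherwise v lies below all of B₂, N(v) agrees with row v on B₂
-- and traces R there. Either way a contradiction, so 2d ≤ |Y| forces VCdim(A) ≥ d.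
module Submission where

open import Defs
open import Data.Nat using (ℕ; _*_; _+_)
open import Data.Bool using (false)
open import Data.Fin using (Fin)
open import Data.Product using (_×_)
open import Relation.Binary.PropositionalEquality using (_≡_)

open import Data.Nat using (zero; suc; z≤n; s≤s; _≤_; _≤?_)
import Data.Nat.Properties as ℕ
open import Data.Nat.Tactic.RingSolver using (solve-∀)
open import Data.Bool using (Bool) renaming (_≟_ to _≟ᵇ_)
open import Data.Bool.Properties using (∨-identityʳ)
open import Data.Fin as Fin using (_<?_)
import Data.Fin.Properties as Fin
open import Data.Fin.Subset using (Subset; inside; outside; _∈_; _∉_; _⊆_; _∩_; _∪_; ∣_∣)
open import Data.Fin.Subset.Properties
  using (anySubset?; _⊆?_; _∈?_; ⊆-antisym; ∪-comm; x∈p∩q⁺; x∈p∩q⁻; x∈p∪q⁺; x∈p∪q⁻)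
open import Data.Vec using (_∷_; []; tabulate; here; there)
open import Data.Vec.Properties using (≡-dec)
open import Data.Product using (∃; _,_)
open import Data.Sum using (_⊎_; inj₁; inj₂; [_,_]) renaming (map to ⊎-map)
open import Function using (_∘_)
open import Relation.Nullary using (¬_; yes; no; contradiction)
open import Relation.Nullary.Decidable using (dec-true; dec-false; _×-dec_; ¬?)
open import Relation.Binary using (tri<; tri≈; tri>)
open import Relation.Binary.PropositionalEquality using (_≢_; refl; sym; trans; cong; cong₂; subst)

private
  variable
    m n k : ℕ

shattered-or-untraced : (F : Family m k) (Y : Subset m) →
                        Shattered F Y ⊎ ∃ λ Z → Z ⊆ Y × (∀ j → Y ∩ F j ≢ Z)
shattered-or-untraced F Y
  with anySubset? (λ Z → (Z ⊆? Y) ×-dec Fin.all? (λ j → ¬? (≡-dec _≟ᵇ_ (Y ∩ F j) Z)))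
... | yes untraced = inj₂ untraced
... | no ¬untraced = inj₁ traced
  where
  traced : Shattered F Y
  traced Z Z⊆Y with Fin.any? (λ j → ≡-dec _≟ᵇ_ (Y ∩ F j) Z)
  ... | yes trace = trace
  ... | no ¬trace = contradiction (Z , (λ {x} → Z⊆Y {x}) , λ j eq → ¬trace (j , eq)) ¬untraced

VCdim≥suc⇒¬VCdim≤ : (F : Family m k) {d : ℕ} → VCdim≥ F (suc d) → ¬ VCdim≤ F d
VCdim≥suc⇒¬VCdim≤ F (Y , ∣Y∣≡1+d , Y-shattered) ≤d =
  ℕ.<-irrefl refl (subst (_≤ _) ∣Y∣≡1+d (≤d Y Y-shattered))

trace-restriction : {X Y S Z W : Subset m} → X ⊆ Y → Y ∩ S ≡ Z ∪ W → Z ⊆ X →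
                    (∀ {x} → x ∈ X → x ∉ W) → X ∩ S ≡ Z
trace-restriction {X = X} {Y} {S} {Z} {W} X⊆Y trace Z⊆X X∩W=∅ = ⊆-antisym ⊆Z Z⊆
  where
  ⊆Z : X ∩ S ⊆ Z
  ⊆Z x∈X∩S with x∈p∩q⁻ X S x∈X∩S
  ... | x∈X , x∈S with x∈p∪q⁻ Z W (subst (_ ∈_) trace (x∈p∩q⁺ (X⊆Y x∈X , x∈S)))
  ...   | inj₁ x∈Z = x∈Z
  ...   | inj₂ x∈W = contradiction x∈W (X∩W=∅ x∈X)
  Z⊆ : Z ⊆ X ∩ S
  Z⊆ x∈Z with x∈p∩q⁻ Y S (subst (_ ∈_) (sym trace) (x∈p∪q⁺ (inj₁ x∈Z)))
  ... | _ , x∈S = x∈p∩q⁺ (Z⊆X x∈Z , x∈S)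

∪-least : {X Y Z : Subset n} → X ⊆ Z → Y ⊆ Z → X ∪ Y ⊆ Z
∪-least {X = X} {Y} X⊆Z Y⊆Z x∈ = [ X⊆Z , Y⊆Z ] (x∈p∪q⁻ X Y x∈)

∩-tabulate-cong : (X : Subset n) {f g : Fin n → Bool} →
                  (∀ {i} → i ∈ X → f i ≡ g i) → X ∩ tabulate f ≡ X ∩ tabulate g
∩-tabulate-cong []            f≗g = refl
∩-tabulate-cong (outside ∷ X) f≗g = cong (outside ∷_) (∩-tabulate-cong X (f≗g ∘ there))
∩-tabulate-cong (inside ∷ X)  f≗g = cong₂ _∷_ (f≗g here) (∩-tabulate-cong X (f≗g ∘ there))

takeˢ : ℕ → Subset n → Subset n
takeˢ k       []            = []
takeˢ zero    (x ∷ X)       = outside ∷ takeˢ zero X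
takeˢ (suc k) (inside ∷ X)  = inside ∷ takeˢ k X
takeˢ (suc k) (outside ∷ X) = outside ∷ takeˢ (suc k) X

dropˢ : ℕ → Subset n → Subset n
dropˢ k       []            = []
dropˢ zero    X             = X
dropˢ (suc k) (inside ∷ X)  = outside ∷ dropˢ k X
dropˢ (suc k) (outside ∷ X) = outside ∷ dropˢ (suc k) X

takeˢ-zero-empty : (X : Subset n) {i : Fin n} → i ∉ takeˢ zero X
takeˢ-zero-empty (x ∷ X) (there i∈) = takeˢ-zero-empty X i∈

takeˢ-⊆ : ∀ k (X : Subset n) → takeˢ k X ⊆ X
takeˢ-⊆ zero    X             i∈         = contradiction i∈ (takeˢ-zero-empty X)
takeˢ-⊆ (suc k) (inside ∷ X)  here       = here
takeˢ-⊆ (suc k) (inside ∷ X)  (there i∈) = there (takeˢ-⊆ k X i∈)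
takeˢ-⊆ (suc k) (outside ∷ X) (there i∈) = there (takeˢ-⊆ (suc k) X i∈)

dropˢ-⊆ : ∀ k (X : Subset n) → dropˢ k X ⊆ X
dropˢ-⊆ zero    (x ∷ X)       i∈         = i∈
dropˢ-⊆ (suc k) (inside ∷ X)  (there i∈) = there (dropˢ-⊆ k X i∈)
dropˢ-⊆ (suc k) (outside ∷ X) (there i∈) = there (dropˢ-⊆ (suc k) X i∈)

takeˢ<dropˢ : ∀ k (X : Subset n) {u w : Fin n} → u ∈ takeˢ k X → w ∈ dropˢ k X → u Fin.< w
takeˢ<dropˢ zero    X             u∈         _          = contradiction u∈ (takeˢ-zero-empty X)
takeˢ<dropˢ (suc k) (inside ∷ X)  here       (there _)  = s≤s z≤n
takeˢ<dropˢ (suc k) (inside ∷ X)  (there u∈) (there w∈) = s≤s (takeˢ<dropˢ k X u∈ w∈)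
takeˢ<dropˢ (suc k) (outside ∷ X) (there u∈) (there w∈) = s≤s (takeˢ<dropˢ (suc k) X u∈ w∈)

∣takeˢ-zero∣ : (X : Subset n) → ∣ takeˢ zero X ∣ ≡ 0
∣takeˢ-zero∣ []      = refl
∣takeˢ-zero∣ (x ∷ X) = ∣takeˢ-zero∣ X

∣takeˢ∣ : ∀ k (X : Subset n) → k ≤ ∣ X ∣ → ∣ takeˢ k X ∣ ≡ k
∣takeˢ∣ zero    X             _       = ∣takeˢ-zero∣ X
∣takeˢ∣ (suc k) (inside ∷ X)  (s≤s k≤) = cong suc (∣takeˢ∣ k X k≤)
∣takeˢ∣ (suc k) (outside ∷ X) k≤       = ∣takeˢ∣ (suc k) X k≤

∣takeˢ∣+∣dropˢ∣ : ∀ k (X : Subset n) → ∣ takeˢ k X ∣ + ∣ dropˢ k X ∣ ≡ ∣ X ∣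
∣takeˢ∣+∣dropˢ∣ k       []            = refl
∣takeˢ∣+∣dropˢ∣ zero    (x ∷ X)       = cong (_+ ∣ x ∷ X ∣) (∣takeˢ-zero∣ (x ∷ X))
∣takeˢ∣+∣dropˢ∣ (suc k) (inside ∷ X)  = cong suc (∣takeˢ∣+∣dropˢ∣ k X)
∣takeˢ∣+∣dropˢ∣ (suc k) (outside ∷ X) = ∣takeˢ∣+∣dropˢ∣ (suc k) X

module _ (A : Matrix n n) where

  upperAdj-above : ∀ {v i} → v Fin.< i → upperAdj A v i ≡ A v i
  upperAdj-above {v} {i} v<i
    rewrite dec-true (v <? i) v<i | dec-false (i <? v) (Fin.<-asym v<i) = ∨-identityʳ (A v i)

  upperAdj-below : (∀ i → A i i ≡ false) → ∀ {v i} → i Fin.≤ v → upperAdj A v i ≡ A i v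
  upperAdj-below diag {v} {i} i≤v with Fin.<-cmp i v
  ... | tri< i<v _ v≮i rewrite dec-false (v <? i) v≮i | dec-true (i <? v) i<v = refl
  ... | tri≈ _ refl _  rewrite dec-false (i <? i) (Fin.<-irrefl refl) = sym (diag i)
  ... | tri> _ _ v<i   = contradiction i≤v (ℕ.<⇒≱ v<i)

  neighbourhood-below : (∀ i → A i i ≡ false) → ∀ {v} (X : Subset n) →
                        (∀ {i} → i ∈ X → i Fin.≤ v) → X ∩ upperNbhd A v ≡ X ∩ columns A v
  neighbourhood-below diag X X≤v = ∩-tabulate-cong X (upperAdj-below diag ∘ X≤v)

  neighbourhood-above : ∀ {v} (X : Subset n) →
                        (∀ {i} → i ∈ X → v Fin.< i) → X ∩ upperNbhd A v ≡ X ∩ rows A v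
  neighbourhood-above X v<X = ∩-tabulate-cong X (upperAdj-above ∘ v<X)

  columns-or-rows-shattered : (∀ i → A i i ≡ false) → {Y B₁ B₂ : Subset n} →
    Shattered (upperNbhd A) Y → B₁ ⊆ Y → B₂ ⊆ Y →
    (∀ {u w} → u ∈ B₁ → w ∈ B₂ → u Fin.< w) →
    Shattered (columns A) B₁ ⊎ Shattered (rows A) B₂
  columns-or-rows-shattered diag {Y} {B₁} {B₂} Y-shattered B₁⊆Y B₂⊆Y B₁<B₂
    with shattered-or-untraced (columns A) B₁ | shattered-or-untraced (rows A) B₂
  ... | inj₁ B₁-shattered | _ = inj₁ B₁-shattered
  ... | inj₂ _ | inj₁ B₂-shattered = inj₂ B₂-shattered
  ... | inj₂ (C , C⊆B₁ , C-untraced) | inj₂ (R , R⊆B₂ , R-untraced)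
    with Y-shattered (C ∪ R) (∪-least (B₁⊆Y ∘ C⊆B₁) (B₂⊆Y ∘ R⊆B₂))
  ... | v , trace with Fin.any? (λ u → (u ∈? B₁) ×-dec (v <? u))
  ...   | yes (u , u∈B₁ , v<u) =
            contradiction
              (trans (sym (neighbourhood-above B₂ (λ i∈B₂ → Fin.<-trans v<u (B₁<B₂ u∈B₁ i∈B₂))))
                     (trace-restriction B₂⊆Y (trans trace (∪-comm C R)) R⊆B₂
                        λ i∈B₂ i∈C → Fin.<-irrefl refl (B₁<B₂ (C⊆B₁ i∈C) i∈B₂)))
              (R-untraced v)
  ...   | no ¬B₁>v =
            contradiction
              (trans (sym (neighbourhood-below diag B₁ (λ i∈B₁ → ℕ.≮⇒≥ (¬B₁>v ∘ (_ ,_) ∘ (i∈B₁ ,_)))))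
                     (trace-restriction B₁⊆Y trace C⊆B₁
                        λ i∈B₁ i∈R → Fin.<-irrefl refl (B₁<B₂ i∈B₁ (R⊆B₂ i∈R))))
              (C-untraced v)

  matVCdim≥-of-shattered : (∀ i → A i i ≡ false) → ∀ d {Y} →
                           Shattered (upperNbhd A) Y → d + d ≤ ∣ Y ∣ → MatVCdim≥ A d
  matVCdim≥-of-shattered diag d {Y} Y-shattered 2d≤∣Y∣ =
    ⊎-map (λ sh → B₁ , ∣takeˢ∣ d Y d≤∣Y∣ , sh) (λ sh → B₂ , ∣takeˢ∣ d D d≤∣D∣ , sh)
          (columns-or-rows-shattered diag Y-shattered
             (takeˢ-⊆ d Y) (dropˢ-⊆ d Y ∘ takeˢ-⊆ d D)
             (λ u∈B₁ w∈B₂ → takeˢ<dropˢ d Y u∈B₁ (takeˢ-⊆ d D w∈B₂)))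
    where
    B₁ D B₂ : Subset n
    B₁ = takeˢ d Y
    D  = dropˢ d Y
    B₂ = takeˢ d D
    d≤∣Y∣ : d ≤ ∣ Y ∣
    d≤∣Y∣ = ℕ.≤-trans (ℕ.m≤m+n d d) 2d≤∣Y∣
    ∣Y∣≡d+∣D∣ : ∣ Y ∣ ≡ d + ∣ D ∣
    ∣Y∣≡d+∣D∣ = trans (sym (∣takeˢ∣+∣dropˢ∣ d Y)) (cong (_+ ∣ D ∣) (∣takeˢ∣ d Y d≤∣Y∣))
    d≤∣D∣ : d ≤ ∣ D ∣
    d≤∣D∣ = ℕ.+-cancelˡ-≤ d d ∣ D ∣ (subst (d + d ≤_) ∣Y∣≡d+∣D∣ 2d≤∣Y∣)

  MatVCdim≥suc⇒¬MatVCdim≤ : ∀ {d} → MatVCdim≥ A (suc d) → ¬ MatVCdim≤ A d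
  MatVCdim≥suc⇒¬MatVCdim≤ (inj₁ columns≥) (columns≤ , _) = VCdim≥suc⇒¬VCdim≤ (columns A) columns≥ columns≤
  MatVCdim≥suc⇒¬MatVCdim≤ (inj₂ rows≥)    (_ , rows≤)    = VCdim≥suc⇒¬VCdim≤ (rows A) rows≥ rows≤

d+d≤4*d : ∀ d → d + d ≤ 4 * d
d+d≤4*d d = ℕ.+-monoʳ-≤ d (ℕ.m≤m+n d _)

4*suc≡suc[4*+3] : ∀ d → 4 * suc d ≡ suc (4 * d + 3)
4*suc≡suc[4*+3] = solve-∀

lemma2 : ∀ (n : ℕ) (A : Matrix n n) → (∀ i → A i i ≡ false) → ∀ (d : ℕ) →
         (VCdim≥ (upperNbhd A) (4 * d) → MatVCdim≥ A d)
         × (MatVCdim≤ A d → VCdim≤ (upperNbhd A) (4 * d + 3))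
lemma2 n A diag d = graph≥⇒matrix≥ , matrix≤⇒graph≤
  where
  graph≥⇒matrix≥ : VCdim≥ (upperNbhd A) (4 * d) → MatVCdim≥ A d
  graph≥⇒matrix≥ (Y , ∣Y∣≡4d , Y-shattered) =
    matVCdim≥-of-shattered A diag d Y-shattered (subst (d + d ≤_) (sym ∣Y∣≡4d) (d+d≤4*d d))

  matrix≤⇒graph≤ : MatVCdim≤ A d → VCdim≤ (upperNbhd A) (4 * d + 3)
  matrix≤⇒graph≤ A≤d Y Y-shattered with ∣ Y ∣ ≤? 4 * d + 3
  ... | yes ∣Y∣≤ = ∣Y∣≤
  ... | no ∣Y∣≰ = contradiction A≤d (MatVCdim≥suc⇒¬MatVCdim≤ A
                    (matVCdim≥-of-shattered A diag (suc d) Y-shattered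
                       (ℕ.≤-trans (d+d≤4*d (suc d))
                                  (subst (_≤ ∣ Y ∣) (sym (4*suc≡suc[4*+3] d)) (ℕ.≰⇒> ∣Y∣≰)))))
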